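{- Let $p$ be an odd prime and let $n,s$ be positive integers such that $2n/s \geq 3$ is an odd integer; put $q = p^n$, $d = p^s$. For any $k = \alpha^d + \alpha \in \mathbb{F}_{q^2}$ (with $\alpha \in \mathbb{F}_{q^2}$), the map \[ \phi_k((a^d + a, x)) = (a^d + a + k,\ x + a^d\alpha + a\alpha^d + \alpha^{d+1}) \] is an automorphism of the graph $\mathcal{A}_{q^2,d}$.
   Context: The map $x \mapsto x^d + x$ is a bijection of $\mathbb{F}_{q^2}$, so every element is uniquely of the form $a^d+a$. $\mathcal{A}_{q^2,d}$ is the graph with vertex set $\mathbb{F}_{q^2} \times \mathbb{F}_{q^2}$ in which distinct vertices $(a^d + a, x)$ and $(b^d + b, y)$ are adjacent iff $a^d b + a b^d = x + y$. -}

module Defs where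

open import Level using (Level; _⊔_)
open import Algebra.Bundles using (CommutativeRing)
import Algebra.Bundles
open import Data.Nat as ℕ using (ℕ; suc; _≤_)
open import Data.Fin using (Fin)
open import Data.Nat.Primality using (Prime)
open import Data.Product using (Σ; ∃; _×_; _,_)
open import Function.Bundles using (Inverse; _⇔_)
open import Relation.Nullary using (¬_)
open import Relation.Binary.PropositionalEquality as ≡ using (_≡_)
import Algebra.Definitions.RawSemiring as RS
open import Data.Product.Relation.Binary.Pointwise.NonDependent using (×-setoid)

TwoNOverSOddAtLeast3 : ℕ → ℕ → Set
TwoNOverSOddAtLeast3 n s =
  Σ ℕ λ m → (2 ℕ.* n ≡ s ℕ.* m) × (3 ≤ m) × (Σ ℕ λ j → m ≡ suc (2 ℕ.* j))

module _ {c ℓ : Level} (R : CommutativeRing c ℓ) where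
  open CommutativeRing R
  open RS (Algebra.Bundles.Semiring.rawSemiring semiring) using (_^_) renaming (_×_ to _·_)

  IsField : Set (c ⊔ ℓ)
  IsField = (¬ (1# ≈ 0#)) × (∀ x → ¬ (x ≈ 0#) → Σ Carrier λ y → x * y ≈ 1#)

  HasChar : ℕ → Set ℓ
  HasChar p = (p · 1#) ≈ 0#

  HasCard : ℕ → Set (c ⊔ ℓ)
  HasCard N = Inverse (≡.setoid (Fin N)) setoid

  IsFq² : ℕ → ℕ → Set (c ⊔ ℓ)
  IsFq² p n = IsField × HasChar p × HasCard ((p ℕ.^ n) ℕ.^ 2)

  module Graph (d : ℕ) where
    V : Set c
    V = Carrier × Carrier

    Vsetoid = ×-setoid setoid setoid

    _≈V_ : V → V → Set ℓ
    (u , x) ≈V (v , y) = (u ≈ v) × (x ≈ y)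

    -- Since a ↦ a^d + a is a bijection, the
    -- witnesses a, b are the unique preimages of the first coordinates.
    Adj : V → V → Set (c ⊔ ℓ)
    Adj (u , x) (v , y) =
      ¬ ((u , x) ≈V (v , y)) ×
      Σ Carrier λ a → Σ Carrier λ b →
        (a ^ d + a ≈ u) × (b ^ d + b ≈ v) ×
        (a ^ d * b + a * b ^ d ≈ x + y)

    IsAutomorphism : (V → V) → Set (c ⊔ ℓ)
    IsAutomorphism φ =
      Σ (Inverse Vsetoid Vsetoid) λ e →
        (∀ w → Inverse.to e w ≈V φ w) ×
        (∀ w z → Adj w z ⇔ Adj (φ w) (φ z))

module Submission where

-- Write τ(a) = a ^ d + a, so vertices are pairs (τ a , x), and let
-- cross a b = a ^ d b + a b ^ d, so that (τ a , x) ~ (τ b , y) iff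
-- cross a b = x + y.  Since d = p ^ s is a power of the characteristic,
-- x ↦ x ^ d is additive (Frobenius); hence τ is additive and
--   cross (a + α) (b + α) = cross a b + (shift a + shift b),
--   shift a = a ^ d α + a α ^ d + α ^ (d + 1),
-- so φ(τ a , x) = (τ a + τ α , x + shift a) preserves and reflects adjacency,
-- with inverse (v , y) ↦ (v − τ α , y − shift (τ⁻¹ (v − τ α))).
-- To compute a from τ a, τ must be injective: if e ^ d = − e then, as
-- q² = d ^ m with m odd, Fermat's little theorem gives e = e ^ (q²) = − e,
-- so e = 0 in odd characteristic; a preimage is then found by exhaustive
-- search in the finite field.

open import Defs
open import Algebra.Bundles using (Monoid; CommutativeRing)
open import Data.Nat as ℕ using (ℕ; zero; suc; _∸_; _!; _<_; _≤_; z≤n; s≤s)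
import Data.Nat.Properties as ℕP
open import Data.Nat.Properties using (_!*_!≢0)
open import Data.Nat.Divisibility using (_∣_; divides; ∣-refl; ∣⇒≤; m∣m*n)
open import Data.Nat.DivMod using (m/n*n≡m)
open import Data.Nat.Primality using (Prime; prime⇒irreducible; prime⇒nonZero; prime⇒nonTrivial; euclidsLemma)
open import Data.Nat.Combinatorics using (_C_; nCk≡n!/k![n-k]!; k![n∸k]!∣n!; nCn≡1; nCk≡nC[n∸k])
open import Data.Fin as Fin using (Fin; zero; suc; toℕ; fromℕ; inject₁; punchIn)
import Data.Fin.Properties as FinP
open import Data.Fin.Permutation using (Permutation)
open import Data.Vec.Functional using (Vector)
open import Data.Product using (Σ; _,_; proj₁; proj₂)
open import Data.Sum using (_⊎_; inj₁; inj₂)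
open import Data.Empty using (⊥-elim)
open import Data.Maybe using (nothing)
open import Function.Bundles using (Inverse; mk↔ₛ′; _⇔_; mk⇔; Equivalence)
open import Function.Definitions using (Congruent)
import Function.Consequences.Setoid as FunctionConsequences
open import Relation.Binary.Bundles using (Setoid)
open import Relation.Binary.Definitions using (Decidable)
open import Relation.Nullary using (¬_; yes; no)
import Relation.Nullary.Decidable as Dec
open import Relation.Binary.PropositionalEquality as ≡ using (_≡_)
open import Tactic.RingSolver.Core.AlmostCommutativeRing using (fromCommutativeRing)

even-or-odd : ∀ n → Σ ℕ λ j → n ≡ 2 ℕ.* j ⊎ n ≡ suc (2 ℕ.* j)
even-or-odd zero = 0 , inj₁ ≡.refl
even-or-odd (suc n) with even-or-odd n
... | j , inj₁ n≡2j = j , inj₂ (≡.cong suc n≡2j)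
... | j , inj₂ n≡1+2j = suc j , inj₁ (≡.trans (≡.cong suc n≡1+2j) (≡.sym (ℕP.*-distribˡ-+ 2 1 j)))

odd-prime : ∀ {p} → Prime p → ¬ (p ≡ 2) → Σ ℕ λ j → p ≡ suc (2 ℕ.* j)
odd-prime {p} pp p≢2 with even-or-odd p
... | j , inj₂ p≡1+2j = j , p≡1+2j
... | j , inj₁ p≡2j with prime⇒irreducible pp (divides j (≡.trans p≡2j (ℕP.*-comm 2 j)))
...   | inj₁ ()
...   | inj₂ 2≡p = ⊥-elim (p≢2 (≡.sym 2≡p))

prime∣!⇒≤ : ∀ {p} → Prime p → ∀ m → p ∣ m ! → p ≤ m
prime∣!⇒≤ pp zero p∣1 = ⊥-elim (ℕP.<⇒≱ (ℕ.nonTrivial⇒n>1 _ {{prime⇒nonTrivial pp}}) (∣⇒≤ p∣1))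
prime∣!⇒≤ pp (suc m) p∣m+1! with euclidsLemma (suc m) (m !) pp p∣m+1!
... | inj₁ p∣m+1 = ∣⇒≤ p∣m+1
... | inj₂ p∣m! = ℕP.m≤n⇒m≤1+n (prime∣!⇒≤ pp m p∣m!)

n∣n! : ∀ n → .{{ℕ.NonZero n}} → n ∣ n !
n∣n! (suc n) = m∣m*n (n !)

-- The prime p divides every inner binomial coefficient p C k, 0 < k < p:
-- it divides p! = (p C k) · k! · (p ∸ k)!, but neither k! nor (p ∸ k)!.
prime∣binomial : ∀ {p} → Prime p → ∀ k → 0 < k → k < p → p ∣ p C k
prime∣binomial {p} pp k 0<k k<p
  with euclidsLemma (p C k) (k ! ℕ.* (p ∸ k) !) pp p∣product
  where
  instance
    k![p∸k]!≢0 : ℕ.NonZero (k ! ℕ.* (p ∸ k) !)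
    k![p∸k]!≢0 = k !* (p ∸ k) !≢0
  k≤p : k ≤ p
  k≤p = ℕP.<⇒≤ k<p
  product≡p! : (p C k) ℕ.* (k ! ℕ.* (p ∸ k) !) ≡ p !
  product≡p! = ≡.trans (≡.cong (ℕ._* (k ! ℕ.* (p ∸ k) !)) (nCk≡n!/k![n-k]! k≤p)) (m/n*n≡m (k![n∸k]!∣n! k≤p))
  p∣p! : p ∣ p !
  p∣p! = n∣n! p {{prime⇒nonZero pp}}
  p∣product : p ∣ (p C k) ℕ.* (k ! ℕ.* (p ∸ k) !)
  p∣product = ≡.subst (p ∣_) (≡.sym product≡p!) p∣p!
... | inj₁ p∣pCk = p∣pCk
... | inj₂ p∣k![p∸k]! with euclidsLemma (k !) ((p ∸ k) !) pp p∣k![p∸k]!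
...   | inj₁ p∣k! = ⊥-elim (ℕP.<⇒≱ k<p (prime∣!⇒≤ pp k p∣k!))
...   | inj₂ p∣[p∸k]! = ⊥-elim (ℕP.<⇒≱ (ℕP.∸-monoʳ-< 0<k (ℕP.<⇒≤ k<p)) (prime∣!⇒≤ pp (p ∸ k) p∣[p∸k]!))

module _ {a ℓ} (M : Monoid a ℓ) where
  open Monoid M renaming (_∙_ to _+_; ε to 0#; ∙-cong to +-cong; ∙-congˡ to +-congˡ)
  open import Algebra.Properties.Monoid.Sum M
  open import Relation.Binary.Reasoning.Setoid setoid

  sum-ends : ∀ {q} (t : Vector Carrier (suc (suc q))) →
             (∀ i → t (suc (inject₁ i)) ≈ 0#) → sum t ≈ t zero + t (fromℕ (suc q))
  sum-ends {q} t inner≈0 = begin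
    sum t                                          ≈⟨ sum-init-last t ⟩
    (t zero + sum (λ i → t (suc (inject₁ i)))) + t (fromℕ (suc q))
      ≈⟨ +-cong (+-congˡ (trans (sum-cong-≋ inner≈0) (sum-replicate-zero q))) refl ⟩
    (t zero + 0#) + t (fromℕ (suc q))              ≈⟨ +-cong (identityʳ _) refl ⟩
    t zero + t (fromℕ (suc q))                     ∎

module Characteristic {c ℓ} (F : CommutativeRing c ℓ) (p : ℕ) (p-prime : Prime p) (char-p : HasChar F p) where
  open CommutativeRing F hiding (zero)
  open import Algebra.Properties.Ring ring using (-‿involutive; +-inverseʳ-unique)
  open import Algebra.Properties.Semiring.Exp semiring
  open import Algebra.Properties.Semiring.Mult semiring
  import Algebra.Properties.CommutativeSemiring.Binomial commutativeSemiring as Binomial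
  open import Relation.Binary.Reasoning.Setoid setoid

  multiple-annihilates : ∀ m x → p ∣ m → m × x ≈ 0#
  multiple-annihilates m x (divides j m≡jp) = begin
    m × x                          ≈⟨ ×-congʳ m (*-identityˡ x) ⟨
    m × (1# * x)                   ≈⟨ ×-assoc-* m 1# x ⟨
    (m × 1#) * x                   ≡⟨ ≡.cong (λ n → (n × 1#) * x) m≡jp ⟩
    ((j ℕ.* p) × 1#) * x           ≈⟨ *-congʳ (×1-homo-* j p) ⟩
    ((j × 1#) * (p × 1#)) * x      ≈⟨ *-congʳ (*-congˡ char-p) ⟩
    ((j × 1#) * 0#) * x            ≈⟨ *-congʳ (zeroʳ _) ⟩
    0# * x                         ≈⟨ zeroˡ x ⟩
    0#                             ∎

  -- If p divides every inner binomial coefficient of n, then x ↦ x ^ n is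
  -- additive: the binomial expansion of (x + y) ^ n collapses to its ends.
  power-additive : ∀ n → 0 ℕ.< n → (∀ k → 0 ℕ.< k → k ℕ.< n → p ∣ n C k) →
                   ∀ x y → (x + y) ^ n ≈ x ^ n + y ^ n
  power-additive (suc q) _ p∣inner x y = begin
    (x + y) ^ suc q                ≈⟨ Binomial.theorem (suc q) x y ⟩
    Binomial.binomialExpansion x y (suc q)
                                   ≈⟨ sum-ends +-monoid term inner≈0 ⟩
    term zero + term (fromℕ (suc q)) ≈⟨ +-cong first≈ last≈ ⟩
    y ^ suc q + x ^ suc q          ≈⟨ +-comm _ _ ⟩
    x ^ suc q + y ^ suc q          ∎
    where
    term : Fin (suc (suc q)) → Carrier
    term = Binomial.binomialTerm x y (suc q)
    first≈ : term zero ≈ y ^ suc q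
    first≈ = begin
      (suc q C 0) × (1# * y ^ suc q)  ≡⟨ ≡.cong (_× (1# * y ^ suc q)) (≡.trans (nCk≡nC[n∸k] {0} {suc q} z≤n) (nCn≡1 (suc q))) ⟩
      1 × (1# * y ^ suc q)            ≈⟨ ×-homo-1 _ ⟩
      1# * y ^ suc q                  ≈⟨ *-identityˡ _ ⟩
      y ^ suc q                       ∎
    last≈ : term (fromℕ (suc q)) ≈ x ^ suc q
    last≈ rewrite FinP.toℕ-fromℕ q | nCn≡1 (suc q) | ℕP.n∸n≡0 (suc q) =
      trans (×-homo-1 _) (*-identityʳ _)
    inner≈0 : ∀ i → term (suc (inject₁ i)) ≈ 0#
    inner≈0 i = multiple-annihilates _ _ (p∣inner _ (s≤s z≤n) (s≤s i<q))
      where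
      i<q : toℕ (inject₁ i) ℕ.< q
      i<q = ≡.subst (ℕ._< q) (≡.sym (FinP.toℕ-inject₁ i)) (FinP.toℕ<n i)

  freshmans-dream : ∀ x y → (x + y) ^ p ≈ x ^ p + y ^ p
  freshmans-dream = power-additive p (ℕ.>-nonZero⁻¹ p {{prime⇒nonZero p-prime}}) (prime∣binomial p-prime)

  frobenius-additive : ∀ s x y → (x + y) ^ (p ℕ.^ s) ≈ x ^ (p ℕ.^ s) + y ^ (p ℕ.^ s)
  frobenius-additive zero x y = distribʳ 1# x y
  frobenius-additive (suc s) x y = begin
    (x + y) ^ (p ℕ.* p ℕ.^ s)                   ≈⟨ ^-assocʳ (x + y) p (p ℕ.^ s) ⟨
    ((x + y) ^ p) ^ (p ℕ.^ s)                   ≈⟨ ^-congˡ (p ℕ.^ s) (freshmans-dream x y) ⟩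
    (x ^ p + y ^ p) ^ (p ℕ.^ s)                 ≈⟨ frobenius-additive s (x ^ p) (y ^ p) ⟩
    (x ^ p) ^ (p ℕ.^ s) + (y ^ p) ^ (p ℕ.^ s)   ≈⟨ +-cong (^-assocʳ x p (p ℕ.^ s)) (^-assocʳ y p (p ℕ.^ s)) ⟩
    x ^ (p ℕ.* p ℕ.^ s) + y ^ (p ℕ.* p ℕ.^ s)   ∎

  frobenius-neg : ∀ s x → (- x) ^ (p ℕ.^ s) ≈ - (x ^ (p ℕ.^ s))
  frobenius-neg s x = +-inverseʳ-unique (x ^ (p ℕ.^ s)) ((- x) ^ (p ℕ.^ s)) (begin
    x ^ (p ℕ.^ s) + (- x) ^ (p ℕ.^ s)   ≈⟨ frobenius-additive s x (- x) ⟨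
    (x - x) ^ (p ℕ.^ s)                 ≈⟨ ^-congˡ (p ℕ.^ s) (-‿inverseʳ x) ⟩
    0# ^ (p ℕ.^ s)                      ≈⟨ zero-power (p ℕ.^ s) p^s>0 ⟩
    0#                                  ∎)
    where
    p^s>0 : 0 ℕ.< p ℕ.^ s
    p^s>0 = ℕP.m^n>0 p {{prime⇒nonZero p-prime}} s
    zero-power : ∀ n → 0 ℕ.< n → 0# ^ n ≈ 0#
    zero-power (suc n) _ = zeroˡ _

  double≈0⇒≈0 : ¬ (p ≡ 2) → ∀ x → x + x ≈ 0# → x ≈ 0#
  double≈0⇒≈0 p≢2 x x+x≈0 with odd-prime p-prime p≢2
  ... | j , p≡1+2j = begin
    x                          ≈⟨ +-identityʳ x ⟨
    x + 0#                     ≈⟨ +-congˡ (×-zero j) ⟨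
    x + j × 0#                 ≈⟨ +-congˡ (×-congʳ j 2x≈0) ⟨
    x + j × (2 × x)            ≈⟨ +-congˡ (×-assocˡ x j 2) ⟩
    x + (j ℕ.* 2) × x          ≡⟨ ≡.cong (λ n → x + n × x) (ℕP.*-comm j 2) ⟩
    suc (2 ℕ.* j) × x          ≡⟨ ≡.cong (_× x) p≡1+2j ⟨
    p × x                      ≈⟨ multiple-annihilates p x ∣-refl ⟩
    0#                         ∎
    where
    2x≈0 : 2 × x ≈ 0#
    2x≈0 = trans (+-congˡ (+-identityʳ x)) x+x≈0
    ×-zero : ∀ n → n × 0# ≈ 0#
    ×-zero zero = refl
    ×-zero (suc n) = trans (+-identityˡ _) (×-zero n)

  -- Let d = p ^ s and suppose every element satisfies x ^ (d ^ (1 + 2j)) = x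
  -- (as in a field with d ^ (1 + 2j) elements).  In odd characteristic the
  -- map e ↦ e ^ d + e then has trivial kernel: e ^ d = - e implies
  -- e = e ^ (d ^ (1 + 2j)) = - e, hence e = 0.
  frobenius-twist-kernel : ¬ (p ≡ 2) → ∀ s j →
    (∀ x → x ^ ((p ℕ.^ s) ℕ.^ suc (2 ℕ.* j)) ≈ x) →
    ∀ e → e ^ (p ℕ.^ s) + e ≈ 0# → e ≈ 0#
  frobenius-twist-kernel p≢2 s j fermat e e^d+e≈0 =
    double≈0⇒≈0 p≢2 e (trans (+-congʳ e≈-e) (-‿inverseˡ e))
    where
    d : ℕ
    d = p ℕ.^ s
    e^d≈-e : e ^ d ≈ - e
    e^d≈-e = +-inverseʳ-unique e (e ^ d) (trans (+-comm e (e ^ d)) e^d+e≈0)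
    power-succ : ∀ n → e ^ (d ℕ.^ suc n) ≈ (e ^ (d ℕ.^ n)) ^ d
    power-succ n = sym (trans (^-assocʳ e (d ℕ.^ n) d) (^-congʳ e (ℕP.*-comm (d ℕ.^ n) d)))
    even-power : ∀ i → e ^ (d ℕ.^ (2 ℕ.* i)) ≈ e
    odd-power : ∀ i → e ^ (d ℕ.^ suc (2 ℕ.* i)) ≈ - e
    even-power zero = *-identityʳ e
    even-power (suc i) = begin
      e ^ (d ℕ.^ (2 ℕ.* suc i))        ≡⟨ ≡.cong (λ n → e ^ (d ℕ.^ n)) (ℕP.*-suc 2 i) ⟩
      e ^ (d ℕ.^ suc (suc (2 ℕ.* i)))  ≈⟨ power-succ (suc (2 ℕ.* i)) ⟩
      (e ^ (d ℕ.^ suc (2 ℕ.* i))) ^ d  ≈⟨ ^-congˡ d (odd-power i) ⟩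
      (- e) ^ d                        ≈⟨ frobenius-neg s e ⟩
      - (e ^ d)                        ≈⟨ -‿cong e^d≈-e ⟩
      - (- e)                          ≈⟨ -‿involutive e ⟩
      e                                ∎
    odd-power i = begin
      e ^ (d ℕ.^ suc (2 ℕ.* i))        ≈⟨ power-succ (2 ℕ.* i) ⟩
      (e ^ (d ℕ.^ (2 ℕ.* i))) ^ d      ≈⟨ ^-congˡ d (even-power i) ⟩
      e ^ d                            ≈⟨ e^d≈-e ⟩
      - e                              ∎
    e≈-e : e ≈ - e
    e≈-e = trans (sym (fermat e)) (odd-power j)

module FiniteSetoid {a ℓ} (S : Setoid a ℓ) {N : ℕ} (card : Inverse (≡.setoid (Fin N)) S) where
  open Setoid S
  open Inverse card

  index-injective : ∀ {u v} → from u ≡ from v → u ≈ v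
  index-injective {u} {v} eq = begin
    u              ≈⟨ strictlyInverseˡ u ⟨
    to (from u)    ≡⟨ ≡.cong to eq ⟩
    to (from v)    ≈⟨ strictlyInverseˡ v ⟩
    v              ∎
    where open import Relation.Binary.Reasoning.Setoid S

  infix 4 _≟_
  _≟_ : Decidable _≈_
  u ≟ v = Dec.map′ index-injective from-cong (from u Fin.≟ from v)

  search : (Carrier → Carrier) → Fin N → Carrier
  search f i with FinP.any? (λ j → from (f (to j)) Fin.≟ i)
  ... | yes (j , _) = to j
  ... | no _ = to i

  preimage : (Carrier → Carrier) → Carrier → Carrier
  preimage f u = search f (from u)

  preimage-cong : ∀ f {u v} → u ≈ v → preimage f u ≡ preimage f v
  preimage-cong f u≈v = ≡.cong (search f) (from-cong u≈v)

  preimage-spec : ∀ f → Congruent _≈_ _≈_ f → ∀ a → f (preimage f (f a)) ≈ f a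
  preimage-spec f f-cong a with FinP.any? (λ j → from (f (to j)) Fin.≟ from (f a))
  ... | yes (j , found) = index-injective found
  ... | no none = ⊥-elim (none (from a , from-cong (f-cong (strictlyInverseˡ a))))

-- Fermat's little theorem for a finite field F with 1 + M elements:
-- multiplication by a unit x permutes F, so comparing the products of all
-- nonzero elements before and after scaling gives x ^ M = 1.
module FiniteField {c ℓ} (F : CommutativeRing c ℓ) (is-field : IsField F)
                   {M : ℕ} (card : HasCard F (suc M)) where
  open CommutativeRing F hiding (zero)
  open import Algebra.Properties.Semiring.Exp semiring using (_^_)
  open import Algebra.Properties.CommutativeMonoid.Sum *-commutativeMonoid
    using (sum-remove; sum-cong-≋; ∑-permute; ∑-distrib-+; sum-replicate)
    renaming (sum to product)
  open import Relation.Binary.Reasoning.Setoid setoid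
  open FiniteSetoid setoid card
  open Inverse card using (to; from; from-cong; strictlyInverseˡ; strictlyInverseʳ)

  1≉0 : ¬ 1# ≈ 0#
  1≉0 = proj₁ is-field

  *-cancelʳ-nonzero : ∀ {r} → ¬ r ≈ 0# → ∀ a b → a * r ≈ b * r → a ≈ b
  *-cancelʳ-nonzero {r} r≉0 a b ar≈br with proj₂ is-field r r≉0
  ... | r⁻¹ , rr⁻¹≈1 = begin
    a                  ≈⟨ *-identityʳ a ⟨
    a * 1#             ≈⟨ *-congˡ rr⁻¹≈1 ⟨
    a * (r * r⁻¹)      ≈⟨ *-assoc a r r⁻¹ ⟨
    (a * r) * r⁻¹      ≈⟨ *-congʳ ar≈br ⟩
    (b * r) * r⁻¹      ≈⟨ *-assoc b r r⁻¹ ⟩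
    b * (r * r⁻¹)      ≈⟨ *-congˡ rr⁻¹≈1 ⟩
    b * 1#             ≈⟨ *-identityʳ b ⟩
    b                  ∎

  nonzero-product : ∀ {a b} → ¬ a ≈ 0# → ¬ b ≈ 0# → ¬ a * b ≈ 0#
  nonzero-product {a} {b} a≉0 b≉0 ab≈0 = a≉0 (*-cancelʳ-nonzero b≉0 a 0# (trans ab≈0 (sym (zeroˡ b))))

  product-nonzero : ∀ {n} (h : Fin n → Carrier) → (∀ i → ¬ h i ≈ 0#) → ¬ product h ≈ 0#
  product-nonzero {zero} h _ = 1≉0
  product-nonzero {suc n} h h≉0 =
    nonzero-product (h≉0 zero) (product-nonzero (λ i → h (suc i)) (λ i → h≉0 (suc i)))

  -- Replacing 0 by 1 turns a product over all of F into the product over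
  -- its nonzero elements.
  unzero : Carrier → Carrier
  unzero y with y ≟ 0#
  ... | yes _ = 1#
  ... | no _ = y

  unzero-zero : ∀ {y} → y ≈ 0# → unzero y ≈ 1#
  unzero-zero {y} y≈0 with y ≟ 0#
  ... | yes _ = refl
  ... | no y≉0 = ⊥-elim (y≉0 y≈0)

  unzero-nonzero : ∀ {y} → ¬ y ≈ 0# → unzero y ≈ y
  unzero-nonzero {y} y≉0 with y ≟ 0#
  ... | yes y≈0 = ⊥-elim (y≉0 y≈0)
  ... | no _ = refl

  unzero≉0 : ∀ y → ¬ unzero y ≈ 0#
  unzero≉0 y with y ≟ 0#
  ... | yes _ = 1≉0
  ... | no y≉0 = y≉0

  unzero-cong : ∀ {y z} → y ≈ z → unzero y ≈ unzero z
  unzero-cong {y} {z} y≈z with y ≟ 0# | z ≟ 0#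
  ... | yes _   | yes _   = refl
  ... | no _    | no _    = y≈z
  ... | yes y≈0 | no z≉0  = ⊥-elim (z≉0 (trans (sym y≈z) y≈0))
  ... | no y≉0  | yes z≈0 = ⊥-elim (y≉0 (trans y≈z z≈0))

  ∏F : (Carrier → Carrier) → Carrier
  ∏F g = product (λ i → g (to i))

  -- Scaling by a unit permutes F, so it does not change ∏F.
  ∏F-scale : ∀ {x y} → x * y ≈ 1# → ∀ g → Congruent _≈_ _≈_ g → ∏F g ≈ ∏F (λ z → g (x * z))
  ∏F-scale {x} {y} xy≈1 g g-cong = begin
    ∏F g                                    ≈⟨ ∑-permute (λ i → g (to i)) scaling ⟩
    product (λ i → g (to (from (x * to i)))) ≈⟨ sum-cong-≋ (λ i → g-cong (strictlyInverseˡ (x * to i))) ⟩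
    ∏F (λ z → g (x * z))                    ∎
    where
    unscale : ∀ {a b} → a * b ≈ 1# → ∀ i → from (a * to (from (b * to i))) ≡ i
    unscale {a} {b} ab≈1 i = ≡.trans (from-cong (begin
      a * to (from (b * to i))   ≈⟨ *-congˡ (strictlyInverseˡ (b * to i)) ⟩
      a * (b * to i)             ≈⟨ *-assoc a b (to i) ⟨
      (a * b) * to i             ≈⟨ *-congʳ ab≈1 ⟩
      1# * to i                  ≈⟨ *-identityˡ (to i) ⟩
      to i                       ∎)) (strictlyInverseʳ i)
    scaling : Permutation (suc M) (suc M)
    scaling = mk↔ₛ′ (λ i → from (x * to i)) (λ i → from (y * to i))
                    (unscale xy≈1) (unscale (trans (*-comm y x) xy≈1))

  zero-index : Fin (suc M)
  zero-index = from 0#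

  nonzero-elem : Fin M → Carrier
  nonzero-elem j = to (punchIn zero-index j)

  nonzero-elem-nonzero : ∀ j → ¬ nonzero-elem j ≈ 0#
  nonzero-elem-nonzero j e≈0 =
    FinP.punchInᵢ≢i zero-index j (≡.trans (≡.sym (strictlyInverseʳ _)) (from-cong e≈0))

  ∏F-split : ∀ g → ∏F g ≈ g (to zero-index) * product (λ j → g (nonzero-elem j))
  ∏F-split g = sum-remove {i = zero-index} (λ i → g (to i))

  unit-power : ∀ x → ¬ x ≈ 0# → x ^ M ≈ 1#
  unit-power x x≉0 with proj₂ is-field x x≉0
  ... | y , xy≈1 = sym (*-cancelʳ-nonzero R≉0 1# (x ^ M) (begin
    1# * R                                            ≈⟨ *-congʳ (unzero-zero (strictlyInverseˡ 0#)) ⟨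
    unzero (to zero-index) * R                        ≈⟨ ∏F-split unzero ⟨
    ∏F unzero                                         ≈⟨ ∏F-scale xy≈1 unzero unzero-cong ⟩
    ∏F (λ z → unzero (x * z))                         ≈⟨ ∏F-split (λ z → unzero (x * z)) ⟩
    unzero (x * to zero-index) * product (λ j → unzero (x * nonzero-elem j))
      ≈⟨ *-cong (unzero-zero x*0≈0) (sum-cong-≋ scaled) ⟩
    1# * product (λ j → x * unzero (nonzero-elem j))  ≈⟨ *-identityˡ _ ⟩
    product (λ j → x * unzero (nonzero-elem j))       ≈⟨ ∑-distrib-+ {M} (λ _ → x) (λ j → unzero (nonzero-elem j)) ⟩
    product {M} (λ _ → x) * R                         ≈⟨ *-congʳ (sum-replicate M) ⟩
    x ^ M * R                                         ∎))
    where
    R : Carrier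
    R = product (λ j → unzero (nonzero-elem j))
    R≉0 : ¬ R ≈ 0#
    R≉0 = product-nonzero (λ j → unzero (nonzero-elem j)) (λ j → unzero≉0 (nonzero-elem j))
    x*0≈0 : x * to zero-index ≈ 0#
    x*0≈0 = trans (*-congˡ (strictlyInverseˡ 0#)) (zeroʳ x)
    scaled : ∀ j → unzero (x * nonzero-elem j) ≈ x * unzero (nonzero-elem j)
    scaled j = trans (unzero-nonzero (nonzero-product x≉0 (nonzero-elem-nonzero j)))
                     (*-congˡ (sym (unzero-nonzero (nonzero-elem-nonzero j))))

  fermat : ∀ x → x ^ suc M ≈ x
  fermat x with x ≟ 0#
  ... | yes x≈0 = trans (*-congʳ x≈0) (trans (zeroˡ _) (sym x≈0))
  ... | no x≉0 = trans (*-congˡ (unit-power x x≉0)) (*-identityʳ x)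

module _ {c ℓ} (F : CommutativeRing c ℓ) (is-field : IsField F) where
  open CommutativeRing F
  open import Algebra.Properties.Semiring.Exp semiring using (_^_)

  -- Fermat's little theorem for any finite field (a field is never empty).
  fermat-little : ∀ {N} → HasCard F N → ∀ x → x ^ N ≈ x
  fermat-little {zero} card x with Inverse.from card x
  ... | ()
  fermat-little {suc M} card = FiniteField.fermat F is-field card

-- Throughout, F is a commutative ring and d an exponent for which x ↦ x ^ d
-- is additive (in the application, a power of the characteristic).
module Twist {c ℓ} (F : CommutativeRing c ℓ) (d : ℕ) where
  open CommutativeRing F
  open import Algebra.Properties.Ring ring using (+-cancelʳ; x∙y⁻¹≈ε⇒x≈y; //-rightDividesˡ; //-rightDividesʳ)
  open import Algebra.Properties.Semiring.Exp semiring
  open import Relation.Binary.Reasoning.Setoid setoid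
  open import Tactic.RingSolver.NonReflective (fromCommutativeRing F (λ _ → nothing))
    using (solve; _⊜_; _⊕_; _⊗_)

  -- The map a ↦ a ^ d + a; a vertex (τ a , x) of the graph has hidden
  -- coordinate a.
  τ : Carrier → Carrier
  τ a = a ^ d + a

  τ-cong : ∀ {a b} → a ≈ b → τ a ≈ τ b
  τ-cong a≈b = +-cong (^-congˡ d a≈b) a≈b

  module _ (additive : ∀ x y → (x + y) ^ d ≈ x ^ d + y ^ d) where

    τ-additive : ∀ a b → τ (a + b) ≈ τ a + τ b
    τ-additive a b = begin
      (a + b) ^ d + (a + b)        ≈⟨ +-congʳ (additive a b) ⟩
      (a ^ d + b ^ d) + (a + b)    ≈⟨ solve 4 (λ A B a b → ((A ⊕ B) ⊕ (a ⊕ b)) ⊜ ((A ⊕ a) ⊕ (B ⊕ b))) refl (a ^ d) (b ^ d) a b ⟩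
      (a ^ d + a) + (b ^ d + b)    ∎

    τ-injective : (∀ e → τ e ≈ 0# → e ≈ 0#) → ∀ {a b} → τ a ≈ τ b → a ≈ b
    τ-injective kernel {a} {b} τa≈τb = x∙y⁻¹≈ε⇒x≈y a b (kernel (a - b) (+-cancelʳ (τ b) (τ (a - b)) 0# (begin
      τ (a - b) + τ b     ≈⟨ τ-additive (a - b) b ⟨
      τ ((a - b) + b)     ≈⟨ τ-cong (//-rightDividesˡ b a) ⟩
      τ a                 ≈⟨ τa≈τb ⟩
      τ b                 ≈⟨ +-identityˡ (τ b) ⟨
      0# + τ b            ∎)))

    -- Given a congruent left inverse pre of τ
    -- (so that every first coordinate τ a remembers its a) and α ∈ F, shift
    -- the hidden coordinate a ↦ a + α and correct the second coordinate so
    -- that the adjacency relation a ^ d b + a b ^ d = x + y is preserved.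
    module Translation (pre : Carrier → Carrier) (pre-cong : ∀ {u v} → u ≈ v → pre u ≈ pre v)
                       (pre-τ : ∀ a → pre (τ a) ≈ a) (α : Carrier) where
      open Graph F d

      pre-of : ∀ {a u} → τ a ≈ u → pre u ≈ a
      pre-of τa≈u = trans (pre-cong (sym τa≈u)) (pre-τ _)

      k : Carrier
      k = τ α

      shift : Carrier → Carrier
      shift a = (a ^ d * α + a * α ^ d) + α ^ (d ℕ.+ 1)

      shift-cong : ∀ {a b} → a ≈ b → shift a ≈ shift b
      shift-cong a≈b = +-congʳ (+-cong (*-congʳ (^-congˡ d a≈b)) (*-congʳ a≈b))

      cross : Carrier → Carrier → Carrier
      cross a b = a ^ d * b + a * b ^ d

      φ : V → V
      φ (u , x) = (u + k , x + shift (pre u))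

      ψ : V → V
      ψ (v , y) = (v - k , y - shift (pre (v - k)))

      φ-cong : ∀ {w z} → w ≈V z → φ w ≈V φ z
      φ-cong (u≈v , x≈y) = +-congʳ u≈v , +-cong x≈y (shift-cong (pre-cong u≈v))

      ψ-cong : ∀ {w z} → w ≈V z → ψ w ≈V ψ z
      ψ-cong {u , x} {v , y} (u≈v , x≈y) = u-k≈v-k , +-cong x≈y (-‿cong (shift-cong (pre-cong u-k≈v-k)))
        where
        u-k≈v-k : u - k ≈ v - k
        u-k≈v-k = +-congʳ u≈v

      φ∘ψ : ∀ w → φ (ψ w) ≈V w
      φ∘ψ (v , y) = //-rightDividesˡ k v , //-rightDividesˡ _ y

      ψ∘φ : ∀ w → ψ (φ w) ≈V w
      ψ∘φ (u , x) = u+k-k≈u , trans (+-congˡ (-‿cong (shift-cong (pre-cong u+k-k≈u)))) (//-rightDividesʳ _ x)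
        where
        u+k-k≈u : (u + k) - k ≈ u
        u+k-k≈u = //-rightDividesʳ k u

      φ-injective : ∀ {w z} → φ w ≈V φ z → w ≈V z
      φ-injective {w} {z} φw≈φz = ≈V-trans (≈V-sym (ψ∘φ w)) (≈V-trans (ψ-cong φw≈φz) (ψ∘φ z))
        where open Setoid Vsetoid using () renaming (trans to ≈V-trans; sym to ≈V-sym)

      φ-inverse : Inverse Vsetoid Vsetoid
      φ-inverse = record
        { to = φ ; from = ψ ; to-cong = φ-cong ; from-cong = ψ-cong
        ; inverse = strictlyInverseˡ⇒inverseˡ φ-cong φ∘ψ , strictlyInverseʳ⇒inverseʳ ψ-cong ψ∘φ }
        where open FunctionConsequences Vsetoid Vsetoid

      τ-translate : ∀ {a u} → τ a ≈ u → τ (a + α) ≈ u + k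
      τ-translate τa≈u = trans (τ-additive _ α) (+-congʳ τa≈u)

      τ-untranslate : ∀ {c u} → τ c ≈ u + k → τ (c - α) ≈ u
      τ-untranslate {c} {u} τc≈u+k = +-cancelʳ k (τ (c - α)) u (begin
        τ (c - α) + k      ≈⟨ τ-additive (c - α) α ⟨
        τ ((c - α) + α)    ≈⟨ τ-cong (//-rightDividesˡ α c) ⟩
        τ c                ≈⟨ τc≈u+k ⟩
        u + k              ∎)

      cross-cong : ∀ {a a′ b b′} → a ≈ a′ → b ≈ b′ → cross a b ≈ cross a′ b′
      cross-cong a≈a′ b≈b′ = +-cong (*-cong (^-congˡ d a≈a′) b≈b′) (*-cong a≈a′ (^-congˡ d b≈b′))

      cross-translate : ∀ a b → cross (a + α) (b + α) ≈ cross a b + (shift a + shift b)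
      cross-translate a b = begin
        (a + α) ^ d * (b + α) + (a + α) * (b + α) ^ d
          ≈⟨ +-cong (*-congʳ (additive a α)) (*-congˡ (additive b α)) ⟩
        (a ^ d + α ^ d) * (b + α) + (a + α) * (b ^ d + α ^ d)
          ≈⟨ expand (a ^ d) (b ^ d) a b α (α ^ d) ⟩
        cross a b + (((a ^ d * α + a * α ^ d) + α ^ d * α) + ((b ^ d * α + b * α ^ d) + α ^ d * α))
          ≈⟨ +-congˡ (+-cong (+-congˡ α^[d+1]) (+-congˡ α^[d+1])) ⟨
        cross a b + (shift a + shift b) ∎
        where
        α^[d+1] : α ^ (d ℕ.+ 1) ≈ α ^ d * α
        α^[d+1] = trans (^-homo-* α d 1) (*-congˡ (*-identityʳ α))
        expand : ∀ A B a b t T → (A + T) * (b + t) + (a + t) * (B + T) ≈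
                 (A * b + a * B) + (((A * t + a * T) + T * t) + ((B * t + b * T) + T * t))
        expand = solve 6 (λ A B a b t T →
          ((A ⊕ T) ⊗ (b ⊕ t) ⊕ (a ⊕ t) ⊗ (B ⊕ T))
            ⊜ ((A ⊗ b ⊕ a ⊗ B) ⊕ (((A ⊗ t ⊕ a ⊗ T) ⊕ T ⊗ t) ⊕ ((B ⊗ t ⊕ b ⊗ T) ⊕ T ⊗ t)))) refl

      adjacency-translate : ∀ {a b u v} x y → τ a ≈ u → τ b ≈ v →
        (cross a b ≈ x + y) ⇔ (cross (a + α) (b + α) ≈ (x + shift (pre u)) + (y + shift (pre v)))
      adjacency-translate {a} {b} {u} {v} x y τa≈u τb≈v = mk⇔
        (λ cross≈ → trans (cross-translate a b) (trans (+-congʳ cross≈) (sym regroup)))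
        (λ cross≈ → +-cancelʳ S (cross a b) (x + y) (trans (sym (cross-translate a b)) (trans cross≈ regroup)))
        where
        S : Carrier
        S = shift a + shift b
        regroup : (x + shift (pre u)) + (y + shift (pre v)) ≈ (x + y) + S
        regroup = trans (+-cong (+-congˡ (shift-cong (pre-of τa≈u))) (+-congˡ (shift-cong (pre-of τb≈v))))
                        (solve 4 (λ x y s t → ((x ⊕ s) ⊕ (y ⊕ t)) ⊜ ((x ⊕ y) ⊕ (s ⊕ t))) refl x y (shift a) (shift b))

      φ-preserves : ∀ w z → Adj w z → Adj (φ w) (φ z)
      φ-preserves (u , x) (v , y) (w≉z , a , b , τa≈u , τb≈v , adjacent) =
        (λ φw≈φz → w≉z (φ-injective φw≈φz)) ,
        a + α , b + α , τ-translate τa≈u , τ-translate τb≈v ,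
        Equivalence.to (adjacency-translate x y τa≈u τb≈v) adjacent

      φ-reflects : ∀ w z → Adj (φ w) (φ z) → Adj w z
      φ-reflects (u , x) (v , y) (φw≉φz , c , e , τc≈ , τe≈ , adjacent) =
        (λ w≈z → φw≉φz (φ-cong w≈z)) ,
        c - α , e - α , τ-untranslate τc≈ , τ-untranslate τe≈ ,
        Equivalence.from (adjacency-translate x y (τ-untranslate τc≈) (τ-untranslate τe≈))
          (trans (cross-cong (//-rightDividesˡ α c) (//-rightDividesˡ α e)) adjacent)

      φ-automorphism : IsAutomorphism φ
      φ-automorphism = φ-inverse , (λ w → refl , refl) , λ w z → mk⇔ (φ-preserves w z) (φ-reflects w z)

      φ-formula : ∀ a x → φ (τ a , x) ≈V (τ a + k , ((x + a ^ d * α) + a * α ^ d) + α ^ (d ℕ.+ 1))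
      φ-formula a x = refl , (begin
        x + shift (pre (τ a))                          ≈⟨ +-congˡ (shift-cong (pre-τ a)) ⟩
        x + ((a ^ d * α + a * α ^ d) + α ^ (d ℕ.+ 1))  ≈⟨ +-assoc x _ _ ⟨
        (x + (a ^ d * α + a * α ^ d)) + α ^ (d ℕ.+ 1)  ≈⟨ +-congʳ (+-assoc x _ _) ⟨
        ((x + a ^ d * α) + a * α ^ d) + α ^ (d ℕ.+ 1)  ∎)

-- Imports used only by the statement below; they come last because the
-- statement's _^_ and _×_ would clash with the ring power and the scalar
-- multiple used in the modules above.
open import Level using (Level)
open import Algebra.Bundles using (Semiring)
open import Algebra.Definitions.RawSemiring using (_^_)
open import Data.Product using (_×_)

mainTheorem10 : {c ℓ : Level} (F : CommutativeRing c ℓ) (p n s : ℕ) →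
  Prime p → ¬ (p ≡ 2) → 0 < n → 0 < s → TwoNOverSOddAtLeast3 n s →
  IsFq² F p n →
  let open CommutativeRing F
      d = p ℕ.^ s
      pw = _^_ (Semiring.rawSemiring semiring)
      open Graph F d
  in (α : Carrier) →
     let k = pw α d + α
     in Σ (V → V) λ φ →
          (∀ a x → φ (pw a d + a , x)
                     ≈V (pw a d + a + k ,
                         x + pw a d * α + a * pw α d + pw α (d ℕ.+ 1))) ×
          IsAutomorphism φ
mainTheorem10 F p n s p-prime p≢2 _ _ (_ , 2n≡sm , _ , j , m≡1+2j) (is-field , char-p , card) α =
  φ , φ-formula , φ-automorphism
  where
  open CommutativeRing F using (setoid; _≈_; 0#; trans; reflexive; semiring)
  open import Algebra.Properties.Semiring.Exp semiring using (^-congʳ)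
  open Characteristic F p p-prime char-p using (frobenius-additive; frobenius-twist-kernel)
  open FiniteSetoid setoid card using (preimage; preimage-cong; preimage-spec)
  d : ℕ
  d = p ℕ.^ s
  open Twist F d

  q²≡d^m : (p ℕ.^ n) ℕ.^ 2 ≡ d ℕ.^ suc (2 ℕ.* j)
  q²≡d^m = begin
    (p ℕ.^ n) ℕ.^ 2            ≡⟨ ℕP.^-*-assoc p n 2 ⟩
    p ℕ.^ (n ℕ.* 2)            ≡⟨ ≡.cong (p ℕ.^_) (ℕP.*-comm n 2) ⟩
    p ℕ.^ (2 ℕ.* n)            ≡⟨ ≡.cong (p ℕ.^_) (≡.trans 2n≡sm (≡.cong (s ℕ.*_) m≡1+2j)) ⟩
    p ℕ.^ (s ℕ.* suc (2 ℕ.* j)) ≡⟨ ℕP.^-*-assoc p s _ ⟨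
    d ℕ.^ suc (2 ℕ.* j)        ∎
    where open ≡.≡-Reasoning

  τ-kernel : ∀ e → τ e ≈ 0# → e ≈ 0#
  τ-kernel = frobenius-twist-kernel p≢2 s j
    (λ x → trans (^-congʳ x (≡.sym q²≡d^m)) (fermat-little F is-field card x))

  pre-cong : ∀ {u v} → u ≈ v → preimage τ u ≈ preimage τ v
  pre-cong u≈v = reflexive (preimage-cong τ u≈v)

  pre-τ : ∀ a → preimage τ (τ a) ≈ a
  pre-τ a = τ-injective (frobenius-additive s) τ-kernel (preimage-spec τ τ-cong a)

  open Translation (frobenius-additive s) (preimage τ) pre-cong pre-τ α
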